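{- Let $H$ be an $n$-vertex $k$-uniform multihypergraph with $m$ edges and let $2\le r\le k$. There exists $\varepsilon=\varepsilon(k)>0$ such that the following holds. If $U\subseteq V(H)$ is such that at least $(1-\varepsilon)m$ edges have at least $k-1$ of their vertices in $U$, then either $H$ has $r$-surplus $\Omega(m)$, or the induced sub-multihypergraph $H[U]$ has $\Omega(m)$ edges (implicit constants depending on $k$).
   Context: An $r$-cut of a $k$-uniform multihypergraph is a partition of the vertex set into $r$ parts; its size is the number of edges (with multiplicity) having at least one vertex in each part. The $r$-surplus of a $k$-uniform multihypergraph with $m$ edges is the maximum size of an $r$-cut minus $\frac{S(k,r)\,r!}{r^k}m$, with $S(k,r)$ the Stirling number of the second kind. -}

module Defs where

open import Data.Nat as ℕ using (ℕ; zero; suc; _+_; _*_; _^_; _⊔_; _∸_)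
open import Data.Nat.Properties using (m^n≢0)
open import Data.Nat using (_!)
open import Data.Integer using (+_)
open import Data.Rational as ℚ using (ℚ; _/_)
open import Data.Fin using (Fin)
open import Data.Fin.Properties using (all?; any?)
open import Data.Fin.Subset using (Subset; _∈_; _∩_; _⊆_; ∣_∣)
open import Data.Fin.Subset.Properties using (_∈?_; _⊆?_)
open import Data.List using (List; []; _∷_; length; filter; map; concatMap; foldr)
open import Data.List.Relation.Unary.All using (All)
open import Data.Vec using (Vec; lookup) renaming ([] to []v; _∷_ to _∷v_)
open import Data.Product using (∃; _,_)
open import Relation.Binary.PropositionalEquality using (_≡_)
open import Relation.Nullary.Decidable using (Dec; _×-dec_)

S : ℕ → ℕ → ℕ
S zero    zero    = 1
S zero    (suc k) = 0
S (suc n) zero    = 0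
S (suc n) (suc k) = suc k * S n (suc k) + S n k

-- A k-uniform multihypergraph on vertex set Fin n: a list of edges
-- (repetitions allowed = multiplicity), each edge a k-element subset.
record MultiHypergraph (n k : ℕ) : Set where
  field
    edges   : List (Subset n)
    uniform : All (λ e → ∣ e ∣ ≡ k) edges
open MultiHypergraph public

#edges : ∀ {n k} → MultiHypergraph n k → ℕ
#edges H = length (edges H)

Cut : ℕ → ℕ → Set
Cut n r = Vec (Fin r) n

allFinList : (r : ℕ) → List (Fin r)
allFinList zero    = []
allFinList (suc r) = Fin.zero ∷ map Fin.suc (allFinList r)
  where import Data.Fin as Fin

allCuts : (n r : ℕ) → List (Cut n r)
allCuts zero    r = []v ∷ []
allCuts (suc n) r = concatMap (λ c → map (_∷v c) (allFinList r)) (allCuts n r)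

IsCutBy : ∀ {n r} → Cut n r → Subset n → Set
IsCutBy {n} {r} c e = (j : Fin r) → ∃ λ v → (v ∈ e) Data.Product.× (lookup c v ≡ j)
  where import Data.Product

isCutBy? : ∀ {n r} (c : Cut n r) (e : Subset n) → Dec (IsCutBy c e)
isCutBy? c e = all? (λ j → any? (λ v → (v ∈? e) ×-dec (lookup c v Data.Fin.≟ j)))
  where import Data.Fin

cutSize : ∀ {n k r} → MultiHypergraph n k → Cut n r → ℕ
cutSize H c = length (filter (isCutBy? c) (edges H))

maxCut : ∀ {n k} → MultiHypergraph n k → (r : ℕ) → ℕ
maxCut {n} H r = foldr _⊔_ 0 (map (cutSize H) (allCuts n r))

-- the coefficient S(k,r) r! / r^k  (r ≥ 1; set to 0 for r = 0, never used)
coeff : (k r : ℕ) → ℚ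
coeff k zero    = ℚ.0ℚ
coeff k (suc r) = (+ (S k (suc r) * (suc r) !)) / (suc r ^ k)
  where instance _ = m^n≢0 (suc r) k

ℕtoℚ : ℕ → ℚ
ℕtoℚ a = + a / 1

surplus : ∀ {n k} → MultiHypergraph n k → (r : ℕ) → ℚ
surplus {k = k} H r = ℕtoℚ (maxCut H r) ℚ.- coeff k r ℚ.* ℕtoℚ (#edges H)

#edgesNearlyIn : ∀ {n k} → MultiHypergraph n k → Subset n → ℕ
#edgesNearlyIn {k = k} H U = length (filter (λ e → k ∸ 1 ℕ.≤? ∣ e ∩ U ∣) (edges H))

#edgesInduced : ∀ {n k} → MultiHypergraph n k → Subset n → ℕ
#edgesInduced H U = length (filter (λ e → e ⊆? U) (edges H))

{-# OPTIONS --safe #-}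

-- Put the vertices outside U into part 0 and colour U uniformly at random with the other
-- s = r − 1 parts. Unless H[U] has εm edges, at least (1 − 2ε)m edges are crossing, with exactly
-- k − 1 vertices in U, and such an edge is cut iff these k − 1 vertices get all s colours. So
-- some cut has at least (1 − 2ε) p m edges, where p is the probability that k − 1 random points
-- cover s colours. The surplus coefficient S(k,r) r!/r^k is the probability q that k − 1 random
-- points in r colours cover s fixed ones, and the extra colour costs a factor: q ≤ p (1 − r^(1−k)).
-- Hence for ε = 1 / (3 k^(2k) + 1) the surplus is at least (p r^(1−k) − 2εp) m ≥ εm.

module Submission where

open import Defs

module CoveringNumbers where
  open import Data.Nat
  open import Data.Nat.Properties
  open import Data.Nat.Solver using (module +-*-Solver)
  open import Relation.Binary.PropositionalEquality
  open import Data.Product using (_,_)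
  open +-*-Solver

  -- covering a t u counts the maps from an a-element set into t + u colours whose image contains
  -- t designated colours: the first point takes one of the u free colours or a designated one.
  covering : ℕ → ℕ → ℕ → ℕ
  covering zero    zero    u = 1
  covering zero    (suc t) u = 0
  covering (suc a) zero    u = u * covering a zero u
  covering (suc a) (suc t) u = u * covering a (suc t) u + suc t * covering a t (suc u)

  covering-sucʳ : ∀ a t u → covering a t (suc u) ≡ covering a t u + covering a (suc t) u
  covering-sucʳ zero    zero    u = refl
  covering-sucʳ zero    (suc t) u = refl
  covering-sucʳ (suc a) zero    u rewrite covering-sucʳ a zero u =
    solve 3 (λ u c c′ → (con 1 :+ u) :* (c :+ c′) := u :* c :+ (u :* c′ :+ con 1 :* (c :+ c′)))
      refl u (covering a zero u) (covering a 1 u)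
  covering-sucʳ (suc a) (suc t) u
    rewrite covering-sucʳ a (suc t) u | covering-sucʳ a t (suc u) | covering-sucʳ a (suc t) u =
    solve 5 (λ u t c c′ d → (con 1 :+ u) :* (c :+ c′) :+ (con 1 :+ t) :* (d :+ (c :+ c′))
                          := (u :* c :+ (con 1 :+ t) :* d) :+ (u :* c′ :+ (con 2 :+ t) :* (c :+ c′)))
      refl u t (covering a (suc t) u) (covering a (2 + t) u) (covering a t (suc u))

  covering-surjections : ∀ a t → covering a t 0 ≡ t ! * S a t
  covering-surjections zero    zero    = refl
  covering-surjections zero    (suc t) = sym (*-zeroʳ (suc t !))
  covering-surjections (suc a) zero    = refl
  covering-surjections (suc a) (suc t)
    rewrite covering-sucʳ a t 0 | covering-surjections a t | covering-surjections a (suc t) =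
    solve 4 (λ t f x y → (con 1 :+ t) :* (f :* x :+ (con 1 :+ t) :* f :* y)
                       := (con 1 :+ t) :* f :* ((con 1 :+ t) :* y :+ x))
      refl t (t !) (S a t) (S a (suc t))

  covering-nothing-designated : ∀ a u → covering a 0 u ≡ u ^ a
  covering-nothing-designated zero    u = refl
  covering-nothing-designated (suc a) u = cong (u *_) (covering-nothing-designated a u)

  covering-positive : ∀ a t u → t ≤ a → 0 < t + u → 0 < covering a t u
  covering-positive zero    zero    u _         _  = z<s
  covering-positive (suc a) zero    u _         0<u =
    *-mono-< 0<u (covering-positive a zero u z≤n 0<u)
  covering-positive (suc a) (suc t) u (s≤s t≤a) _  = begin-strict
    0                                                       <⟨ positive ⟩
    covering a t (suc u)                                    ≤⟨ m≤m+n _ _ ⟩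
    suc t * covering a t (suc u)                            ≤⟨ m≤n+m _ (u * covering a (suc t) u) ⟩
    u * covering a (suc t) u + suc t * covering a t (suc u) ∎
    where
    open ≤-Reasoning
    positive = covering-positive a t (suc u) t≤a (subst (0 <_) (sym (+-suc t u)) z<s)

  covering-suc-≥ : ∀ a t u → (t + u) * covering a t u ≤ covering (suc a) t u
  covering-suc-≥ a zero    u = ≤-refl
  covering-suc-≥ a (suc t) u = begin
    (suc t + u) * c                      ≡⟨ *-distribʳ-+ c (suc t) u ⟩
    suc t * c + u * c                    ≤⟨ +-monoˡ-≤ (u * c) (*-monoʳ-≤ (suc t) c≤d) ⟩
    suc t * covering a t (suc u) + u * c ≡⟨ +-comm _ (u * c) ⟩
    covering (suc a) (suc t) u           ∎
    where
    open ≤-Reasoning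
    c = covering a (suc t) u
    c≤d : c ≤ covering a t (suc u)
    c≤d = subst (c ≤_) (sym (covering-sucʳ a t u)) (m≤n+m c (covering a t u))

  private
    gap-arithmetic : ∀ B u c C C′ P W →
      C′ * P + suc u * c ≤ (c + C) * W → B * c ≤ C → 0 < W → C′ * (B * P) + C ≤ C * (suc B * W)
    gap-arithmetic B u c C C′ P (suc w) h Bc≤C _ with m≤n⇒∃[o]m+o≡n Bc≤C
    ... | e , refl = +-cancelʳ-≤ (B * (suc u * c)) _ _ (begin
      C′ * (B * P) + C + B * (suc u * c)
        ≡⟨ solve 5 (λ B C C′ P v → C′ :* (B :* P) :+ C :+ B :* v := B :* (C′ :* P :+ v) :+ C)
             refl B C C′ P (suc u * c) ⟩
      B * (C′ * P + suc u * c) + C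
        ≤⟨ +-monoˡ-≤ C (*-monoʳ-≤ B h) ⟩
      B * ((c + C) * suc w) + C
        ≤⟨ m≤m+n _ (e * w + B * u * c) ⟩
      B * ((c + C) * suc w) + C + (e * w + B * u * c)
        ≡⟨ solve 5 (λ B u c e w →
             B :* ((c :+ (B :* c :+ e)) :* (con 1 :+ w)) :+ (B :* c :+ e) :+ (e :* w :+ B :* u :* c)
             := (B :* c :+ e) :* ((con 1 :+ B) :* (con 1 :+ w)) :+ B :* ((con 1 :+ u) :* c))
             refl B u c e w ⟩
      C * (suc B * suc w) + B * (suc u * c) ∎)
      where open ≤-Reasoning

  mutual
    covering-antitone : ∀ a t u → covering a t (suc u) * (t + u) ^ a ≤ covering a t u * (t + suc u) ^ a
    covering-antitone a zero    u
      rewrite covering-nothing-designated a (suc u) | covering-nothing-designated a u =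
      ≤-reflexive (*-comm (suc u ^ a) (u ^ a))
    covering-antitone a (suc t) u = begin
      covering a (suc t) (suc u) * (suc t + u) ^ a
        ≤⟨ m≤m+n _ _ ⟩
      covering a (suc t) (suc u) * (suc t + u) ^ a + covering a (suc t) u
        ≤⟨ covering-gap a t u ⟩
      covering a (suc t) u * suc (suc t + u) ^ a
        ≡⟨ cong (λ b → covering a (suc t) u * b ^ a) (+-suc (suc t) u) ⟨
      covering a (suc t) u * (suc t + suc u) ^ a ∎
      where open ≤-Reasoning

    -- With p u = covering a (suc t) u / (suc t + u) ^ a, this says p (suc u) ≤ p u (1 − 1 / W)
    -- for W = (suc t + suc u) ^ a: the points taking the new colour can only hurt, and with
    -- probability 1 / W all of them do.
    covering-gap : ∀ a t u → covering a (suc t) (suc u) * (suc t + u) ^ a + covering a (suc t) u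
                               ≤ covering a (suc t) u * suc (suc t + u) ^ a
    covering-gap zero    t u = z≤n
    covering-gap (suc a) t u =
      gap-arithmetic B u c (covering (suc a) T u) (covering (suc a) T (suc u)) (B ^ a) W
        recurrence-bound (covering-suc-≥ a T u) (m^n>0 (suc B) a)
      where
      open ≤-Reasoning
      T = suc t
      B = T + u
      W = suc B ^ a
      c = covering a T u
      c′ = covering a T (suc u)
      d = covering a t (suc u)
      d′ = covering a t (suc (suc u))
      d-antitone : d′ * B ^ a ≤ d * W
      d-antitone = subst₂ (λ x y → d′ * x ^ a ≤ d * y ^ a)
        (+-suc t u) (trans (+-suc t (suc u)) (cong suc (+-suc t u))) (covering-antitone a t (suc u))
      recurrence-bound : covering (suc a) T (suc u) * B ^ a + suc u * c
                           ≤ (c + covering (suc a) T u) * W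
      recurrence-bound = begin
        (suc u * c′ + T * d′) * B ^ a + suc u * c
          ≡⟨ solve 6 (λ v c c′ T d′ P → (v :* c′ :+ T :* d′) :* P :+ v :* c
                                      := v :* (c′ :* P :+ c) :+ T :* (d′ :* P))
               refl (suc u) c c′ T d′ (B ^ a) ⟩
        suc u * (c′ * B ^ a + c) + T * (d′ * B ^ a)
          ≤⟨ +-mono-≤ (*-monoʳ-≤ (suc u) (covering-gap a t u)) (*-monoʳ-≤ T d-antitone) ⟩
        suc u * (c * W) + T * (d * W)
          ≡⟨ solve 5 (λ u c T d W → (con 1 :+ u) :* (c :* W) :+ T :* (d :* W)
                                  := (c :+ (u :* c :+ T :* d)) :* W)
               refl u c T d W ⟩
        (c + (u * c + T * d)) * W ∎

module ListSums where
  open import Data.Nat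
  open import Data.Nat.Properties
  open import Algebra.Properties.CommutativeSemigroup +-commutativeSemigroup using (interchange)
  open import Data.List using (List; []; _∷_; _++_; map; concatMap; length; filter; foldr)
  open import Data.List.Membership.Propositional using (_∈_)
  open import Data.List.Relation.Unary.All using (All; []; _∷_)
  open import Data.List.Relation.Unary.Any using (here; there)
  open import Relation.Binary.PropositionalEquality
  open import Relation.Nullary using (Dec; yes; no; ¬?; _×-dec_)
  open import Relation.Unary using (Decidable)
  open import Data.Empty using (⊥-elim)

  private
    variable
      A B : Set

  ∑ : List A → (A → ℕ) → ℕ
  ∑ []       f = 0
  ∑ (x ∷ xs) f = f x + ∑ xs f

  syntax ∑ xs (λ x → e) = ∑[ x ← xs ] e

  ∑-cong : ∀ (xs : List A) {f g : A → ℕ} → (∀ x → f x ≡ g x) → ∑ xs f ≡ ∑ xs g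
  ∑-cong []       f≗g = refl
  ∑-cong (x ∷ xs) f≗g = cong₂ _+_ (f≗g x) (∑-cong xs f≗g)

  ∑-mono : ∀ (xs : List A) {f g : A → ℕ} → (∀ x → f x ≤ g x) → ∑ xs f ≤ ∑ xs g
  ∑-mono []       f≤g = z≤n
  ∑-mono (x ∷ xs) f≤g = +-mono-≤ (f≤g x) (∑-mono xs f≤g)

  ∑-mono-All : ∀ {xs : List A} {f g : A → ℕ} → All (λ x → f x ≤ g x) xs → ∑ xs f ≤ ∑ xs g
  ∑-mono-All []           = z≤n
  ∑-mono-All (fx≤gx ∷ f≤g) = +-mono-≤ fx≤gx (∑-mono-All f≤g)

  ∑-+ : ∀ (xs : List A) f g → ∑[ x ← xs ] (f x + g x) ≡ ∑ xs f + ∑ xs g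
  ∑-+ []       f g = refl
  ∑-+ (x ∷ xs) f g =
    trans (cong (f x + g x +_) (∑-+ xs f g)) (interchange (f x) (g x) (∑ xs f) (∑ xs g))

  ∑-*ʳ : ∀ (xs : List A) f c → ∑[ x ← xs ] (f x * c) ≡ ∑ xs f * c
  ∑-*ʳ []       f c = refl
  ∑-*ʳ (x ∷ xs) f c = trans (cong (f x * c +_) (∑-*ʳ xs f c)) (sym (*-distribʳ-+ c (f x) (∑ xs f)))

  ∑-const : ∀ (xs : List A) c → ∑[ _ ← xs ] c ≡ length xs * c
  ∑-const []       c = refl
  ∑-const (x ∷ xs) c = cong (c +_) (∑-const xs c)

  ∑-swap : ∀ (xs : List A) (ys : List B) (f : A → B → ℕ) →
           ∑[ x ← xs ] ∑[ y ← ys ] f x y ≡ ∑[ y ← ys ] ∑[ x ← xs ] f x y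
  ∑-swap []       ys f = sym (trans (∑-const ys 0) (*-zeroʳ (length ys)))
  ∑-swap (x ∷ xs) ys f = trans (cong (∑ ys (f x) +_) (∑-swap xs ys f)) (sym (∑-+ ys (f x) _))

  ∑-map : ∀ (g : A → B) xs f → ∑ (map g xs) f ≡ ∑[ x ← xs ] f (g x)
  ∑-map g []       f = refl
  ∑-map g (x ∷ xs) f = cong (f (g x) +_) (∑-map g xs f)

  ∑-++ : ∀ (xs ys : List A) f → ∑ (xs ++ ys) f ≡ ∑ xs f + ∑ ys f
  ∑-++ []       ys f = refl
  ∑-++ (x ∷ xs) ys f = trans (cong (f x +_) (∑-++ xs ys f)) (sym (+-assoc (f x) _ _))

  ∑-concatMap : ∀ (h : A → List B) xs f → ∑ (concatMap h xs) f ≡ ∑[ x ← xs ] ∑ (h x) f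
  ∑-concatMap h []       f = refl
  ∑-concatMap h (x ∷ xs) f =
    trans (∑-++ (h x) (concatMap h xs) f) (cong (∑ (h x) f +_) (∑-concatMap h xs f))

  𝟙 : {P : Set} → Dec P → ℕ
  𝟙 (yes _) = 1
  𝟙 (no  _) = 0

  𝟙-mono : {P Q : Set} → (P → Q) → (p : Dec P) (q : Dec Q) → 𝟙 p ≤ 𝟙 q
  𝟙-mono P⇒Q (yes P) (yes _) = ≤-refl
  𝟙-mono P⇒Q (yes P) (no ¬Q) = ⊥-elim (¬Q (P⇒Q P))
  𝟙-mono P⇒Q (no  _) _       = z≤n

  𝟙-split : {P Q : Set} (p : Dec P) (q : Dec Q) → 𝟙 p ≤ 𝟙 (p ×-dec ¬? q) + 𝟙 q
  𝟙-split (yes _) (yes _) = ≤-refl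
  𝟙-split (yes _) (no  _) = ≤-refl
  𝟙-split (no  _) _       = z≤n

  length-filter : ∀ {P : A → Set} (P? : Decidable P) xs →
                  length (filter P? xs) ≡ ∑[ x ← xs ] 𝟙 (P? x)
  length-filter P? []       = refl
  length-filter P? (x ∷ xs) with P? x
  ... | yes _ = cong suc (length-filter P? xs)
  ... | no  _ = length-filter P? xs

  ≤-foldr-⊔ : ∀ (f : A → ℕ) {x xs} → x ∈ xs → f x ≤ foldr _⊔_ 0 (map f xs)
  ≤-foldr-⊔ f {xs = y ∷ ys} (here refl) = m≤m⊔n (f y) _
  ≤-foldr-⊔ f {xs = y ∷ ys} (there x∈ys) = ≤-trans (≤-foldr-⊔ f x∈ys) (m≤n⊔m (f y) _)

module CutAveraging where
  open import Data.Nat hiding (∣_-_∣)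
  open import Data.Nat.Properties
  open import Algebra.Properties.CommutativeSemigroup +-commutativeSemigroup
    using () renaming (x∙yz≈y∙xz to x+[y+z]≡y+[x+z])
  open import Algebra.Properties.CommutativeSemigroup *-commutativeSemigroup
    using () renaming (x∙yz≈y∙xz to x*[y*z]≡y*[x*z])
  open import Data.Bool using (if_then_else_)
  open import Data.Empty using (⊥-elim)
  open import Data.Fin using (Fin; zero; suc) renaming (_≟_ to _≟ᶠ_)
  open import Data.Fin.Properties using (all?; any?; ¬∀⟶∃¬)
  open import Data.Fin.Subset using (Subset; _∈_; _∉_; _∩_; _⊈_; _─_; _-_; ∣_∣; ⊥; ⊤; inside; outside)
  open import Data.Fin.Subset.Properties
    using ( _∈?_; _⊆?_; ∈⊤; ∣⊤∣≡n; ∣p∣≤n; x∈p∩q⁻; p∩q⊆p; p─⊥≡p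
          ; x∈p∧x≢y⇒x∈p-y; x∈p⇒∣p-x∣<∣p∣; p⊂q⇒∣p∣<∣q∣)
  open import Data.List using (map; filter; length)
  open import Data.List.Properties using (length-map)
  open import Data.List.Membership.Propositional using (lose) renaming (_∈_ to _∈ˡ_)
  open import Data.List.Membership.Propositional.Properties using (∈-map⁺; ∈-concatMap⁺)
  open import Data.List.Relation.Unary.All as All using ()
  open import Data.List.Relation.Unary.Any using () renaming (here to hereˡ; there to thereˡ)
  open import Data.Product using (∃; _×_; _,_; proj₂)
  open import Data.Vec using ([]; _∷_; lookup; here; there)
  open import Function using (_∘_; const)
  open import Relation.Binary.PropositionalEquality
  open import Relation.Nullary using (yes; no; ¬?; _×-dec_; _→-dec_; decidable-stable)
  open import Relation.Unary using (Decidable)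
  open CoveringNumbers
  open ListSums

  ∈-allFinList : ∀ {s} (x : Fin s) → x ∈ˡ allFinList s
  ∈-allFinList zero    = hereˡ refl
  ∈-allFinList (suc x) = thereˡ (∈-map⁺ suc (∈-allFinList x))

  ∈-allCuts : ∀ {n s} (g : Cut n s) → g ∈ˡ allCuts n s
  ∈-allCuts []      = hereˡ refl
  ∈-allCuts (x ∷ g) = ∈-concatMap⁺ _ (lose (∈-allCuts g) (∈-map⁺ (_∷ g) (∈-allFinList x)))

  length-allFinList : ∀ s → length (allFinList s) ≡ s
  length-allFinList zero    = refl
  length-allFinList (suc s) = cong suc (trans (length-map suc (allFinList s)) (length-allFinList s))

  ∑-allFinList-const : ∀ s c → ∑[ _ ← allFinList s ] c ≡ s * c
  ∑-allFinList-const s c = trans (∑-const (allFinList s) c) (cong (_* c) (length-allFinList s))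

  ∑-allCuts-suc : ∀ {s} n (F : Cut (suc n) s → ℕ) →
                  ∑ (allCuts (suc n) s) F ≡ ∑[ g ← allCuts n s ] ∑[ x ← allFinList s ] F (x ∷ g)
  ∑-allCuts-suc {s} n F =
    trans (∑-concatMap (λ g → map (_∷ g) (allFinList s)) (allCuts n s) F)
          (∑-cong (allCuts n s) (λ g → ∑-map (_∷ g) (allFinList s) F))

  ∑-allCuts-const : ∀ n s c → ∑[ _ ← allCuts n s ] c ≡ s ^ n * c
  ∑-allCuts-const zero    s c = refl
  ∑-allCuts-const (suc n) s c = begin
    ∑[ _ ← allCuts (suc n) s ] c                  ≡⟨ ∑-allCuts-suc n (const c) ⟩
    ∑[ _ ← allCuts n s ] ∑[ _ ← allFinList s ] c  ≡⟨ ∑-cong (allCuts n s) (λ _ → ∑-allFinList-const s c) ⟩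
    ∑[ _ ← allCuts n s ] (s * c)                  ≡⟨ ∑-allCuts-const n s (s * c) ⟩
    s ^ n * (s * c)                               ≡⟨ *-assoc (s ^ n) s c ⟨
    s ^ n * s * c                                 ≡⟨ cong (_* c) (*-comm (s ^ n) s) ⟩
    s * s ^ n * c                                 ∎
    where open ≡-Reasoning

  Covers : ∀ {n s} → Subset n → Subset s → Cut n s → Set
  Covers A T g = ∀ j → j ∈ T → ∃ λ v → v ∈ A × lookup g v ≡ j

  covers? : ∀ {n s} (A : Subset n) (T : Subset s) → Decidable (Covers A T)
  covers? A T g = all? (λ j → j ∈? T →-dec any? (λ v → v ∈? A ×-dec lookup g v ≟ᶠ j))

  #covers : ∀ {n s} → Subset n → Subset s → ℕ
  #covers {n} {s} A T = ∑[ g ← allCuts n s ] 𝟙 (covers? A T g)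

  Covers-outside : ∀ {n s} (A : Subset n) (T : Subset s) g x →
                   Covers A T g → Covers (outside ∷ A) T (x ∷ g)
  Covers-outside A T g x covers j j∈T with covers j j∈T
  ... | v , v∈A , gv≡j = suc v , there v∈A , gv≡j

  Covers-inside : ∀ {n s} (A : Subset n) (T : Subset s) g x →
                  Covers A (T - x) g → Covers (inside ∷ A) T (x ∷ g)
  Covers-inside A T g x covers j j∈T with j ≟ᶠ x
  ... | yes refl = zero , here , refl
  ... | no  j≢x with covers j (x∈p∧x≢y⇒x∈p-y j∈T j≢x)
  ...   | v , v∈A , gv≡j = suc v , there v∈A , gv≡j

  #covers-outside : ∀ {n s} (A : Subset n) (T : Subset s) → s * #covers A T ≤ #covers (outside ∷ A) T
  #covers-outside {n} {s} A T = begin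
    s * ∑[ g ← G ] 𝟙 (covers? A T g)
      ≡⟨ *-comm s _ ⟩
    (∑[ g ← G ] 𝟙 (covers? A T g)) * s
      ≡⟨ ∑-*ʳ G (𝟙 ∘ covers? A T) s ⟨
    ∑[ g ← G ] (𝟙 (covers? A T g) * s)
      ≡⟨ ∑-cong G (λ g → trans (*-comm _ s) (sym (∑-allFinList-const s _))) ⟩
    ∑[ g ← G ] ∑[ x ← allFinList s ] 𝟙 (covers? A T g)
      ≤⟨ ∑-mono G (λ g → ∑-mono (allFinList s) (λ x →
           𝟙-mono (Covers-outside A T g x) (covers? A T g) (covers? (outside ∷ A) T (x ∷ g)))) ⟩
    ∑[ g ← G ] ∑[ x ← allFinList s ] 𝟙 (covers? (outside ∷ A) T (x ∷ g))
      ≡⟨ ∑-allCuts-suc n (𝟙 ∘ covers? (outside ∷ A) T) ⟨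
    #covers (outside ∷ A) T ∎
    where
    open ≤-Reasoning
    G = allCuts n s

  #covers-inside : ∀ {n s} (A : Subset n) (T : Subset s) →
                   ∑[ x ← allFinList s ] #covers A (T - x) ≤ #covers (inside ∷ A) T
  #covers-inside {n} {s} A T = begin
    ∑[ x ← allFinList s ] ∑[ g ← G ] 𝟙 (covers? A (T - x) g)
      ≡⟨ ∑-swap (allFinList s) G (λ x g → 𝟙 (covers? A (T - x) g)) ⟩
    ∑[ g ← G ] ∑[ x ← allFinList s ] 𝟙 (covers? A (T - x) g)
      ≤⟨ ∑-mono G (λ g → ∑-mono (allFinList s) (λ x →
           𝟙-mono (Covers-inside A T g x) (covers? A (T - x) g) (covers? (inside ∷ A) T (x ∷ g)))) ⟩
    ∑[ g ← G ] ∑[ x ← allFinList s ] 𝟙 (covers? (inside ∷ A) T (x ∷ g))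
      ≡⟨ ∑-allCuts-suc n (𝟙 ∘ covers? (inside ∷ A) T) ⟨
    #covers (inside ∷ A) T ∎
    where
    open ≤-Reasoning
    G = allCuts n s

  ∑-f∣T-x∣ : ∀ {s} (T : Subset s) (f : ℕ → ℕ) →
             ∑[ x ← allFinList s ] f ∣ T - x ∣ ≡ ∣ T ∣ * f (pred ∣ T ∣) + (s ∸ ∣ T ∣) * f ∣ T ∣
  ∑-f∣T-x∣ {zero}  []            f = refl
  ∑-f∣T-x∣ {suc s} (outside ∷ T) f = begin
    f ∣ T ─ ⊥ ∣ + ∑[ x ← map suc (allFinList s) ] f ∣ (outside ∷ T) - x ∣
      ≡⟨ cong₂ _+_ (cong (f ∘ ∣_∣) (p─⊥≡p T)) (∑-map suc (allFinList s) _) ⟩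
    f ∣ T ∣ + ∑[ x ← allFinList s ] f ∣ T - x ∣
      ≡⟨ cong (f ∣ T ∣ +_) (∑-f∣T-x∣ T f) ⟩
    f ∣ T ∣ + (∣ T ∣ * f (pred ∣ T ∣) + (s ∸ ∣ T ∣) * f ∣ T ∣)
      ≡⟨ x+[y+z]≡y+[x+z] (f ∣ T ∣) (∣ T ∣ * f (pred ∣ T ∣)) ((s ∸ ∣ T ∣) * f ∣ T ∣) ⟩
    ∣ T ∣ * f (pred ∣ T ∣) + suc (s ∸ ∣ T ∣) * f ∣ T ∣
      ≡⟨ cong (λ z → ∣ T ∣ * f (pred ∣ T ∣) + z * f ∣ T ∣) (+-∸-assoc 1 (∣p∣≤n T)) ⟨
    ∣ T ∣ * f (pred ∣ T ∣) + (suc s ∸ ∣ T ∣) * f ∣ T ∣ ∎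
    where open ≡-Reasoning
  ∑-f∣T-x∣ {suc s} (inside ∷ T) f = begin
    f ∣ T ─ ⊥ ∣ + ∑[ x ← map suc (allFinList s) ] f ∣ (inside ∷ T) - x ∣
      ≡⟨ cong₂ _+_ (cong (f ∘ ∣_∣) (p─⊥≡p T)) (∑-map suc (allFinList s) _) ⟩
    f ∣ T ∣ + ∑[ x ← allFinList s ] f (suc ∣ T - x ∣)
      ≡⟨ cong (f ∣ T ∣ +_) (∑-f∣T-x∣ T (f ∘ suc)) ⟩
    f ∣ T ∣ + (∣ T ∣ * f (suc (pred ∣ T ∣)) + (s ∸ ∣ T ∣) * f (suc ∣ T ∣))
      ≡⟨ cong (λ z → f ∣ T ∣ + (z + (s ∸ ∣ T ∣) * f (suc ∣ T ∣))) (*-suc-pred ∣ T ∣) ⟩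
    f ∣ T ∣ + (∣ T ∣ * f ∣ T ∣ + (s ∸ ∣ T ∣) * f (suc ∣ T ∣))
      ≡⟨ +-assoc (f ∣ T ∣) _ _ ⟨
    suc ∣ T ∣ * f ∣ T ∣ + (s ∸ ∣ T ∣) * f (suc ∣ T ∣) ∎
    where
    open ≡-Reasoning
    *-suc-pred : ∀ t → t * f (suc (pred t)) ≡ t * f t
    *-suc-pred zero    = refl
    *-suc-pred (suc t) = refl

  ∑-covering-∣T-x∣ : ∀ {s} a (T : Subset s) →
    ∑[ x ← allFinList s ] covering a (∣ T - x ∣) (s ∸ ∣ T - x ∣) ≡ covering (suc a) ∣ T ∣ (s ∸ ∣ T ∣)
  ∑-covering-∣T-x∣ {s} a T =
    trans (∑-f∣T-x∣ T (λ t → covering a t (s ∸ t))) (recurrence ∣ T ∣ (∣p∣≤n T))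
    where
    recurrence : ∀ t → t ≤ s → t * covering a (pred t) (s ∸ pred t) + (s ∸ t) * covering a t (s ∸ t)
                               ≡ covering (suc a) t (s ∸ t)
    recurrence zero    _   = refl
    recurrence (suc t) t<s rewrite +-∸-assoc 1 t<s =
      +-comm (suc t * covering a t (suc (s ∸ suc t))) ((s ∸ suc t) * covering a (suc t) (s ∸ suc t))

  covering≤#covers : ∀ {s} n (A : Subset n) (T : Subset s) →
                     covering ∣ A ∣ ∣ T ∣ (s ∸ ∣ T ∣) * s ^ n ≤ #covers A T * s ^ ∣ A ∣
  covering≤#covers {s} zero []          T = *-monoˡ-≤ 1 (≤-trans base (m≤m+n _ 0))
    where
    base : covering 0 ∣ T ∣ (s ∸ ∣ T ∣) ≤ 𝟙 (covers? [] T [])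
    base with ∣ T ∣ in ∣T∣≡0 | covers? [] T []
    ... | zero  | yes _       = ≤-refl
    ... | zero  | no  ¬covers =
      ⊥-elim (¬covers λ j j∈T → ⊥-elim (n≮0 (subst (0 <_) ∣T∣≡0 (≤-<-trans z≤n (x∈p⇒∣p-x∣<∣p∣ j∈T)))))
    ... | suc _ | _           = z≤n
  covering≤#covers {s} (suc n) (outside ∷ A) T = begin
    c * (s * s ^ n)                       ≡⟨ x*[y*z]≡y*[x*z] c s (s ^ n) ⟩
    s * (c * s ^ n)                       ≤⟨ *-monoʳ-≤ s (covering≤#covers n A T) ⟩
    s * (#covers A T * s ^ ∣ A ∣)         ≡⟨ *-assoc s _ _ ⟨
    s * #covers A T * s ^ ∣ A ∣           ≤⟨ *-monoˡ-≤ (s ^ ∣ A ∣) (#covers-outside A T) ⟩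
    #covers (outside ∷ A) T * s ^ ∣ A ∣   ∎
    where
    open ≤-Reasoning
    c = covering ∣ A ∣ ∣ T ∣ (s ∸ ∣ T ∣)
  covering≤#covers {s} (suc n) (inside ∷ A) T = begin
    covering (suc ∣ A ∣) ∣ T ∣ (s ∸ ∣ T ∣) * (s * s ^ n)
      ≡⟨ cong (_* (s * s ^ n)) (∑-covering-∣T-x∣ ∣ A ∣ T) ⟨
    (∑[ x ← allFinList s ] c x) * (s * s ^ n)
      ≡⟨ x*[y*z]≡y*[x*z] (∑[ x ← allFinList s ] c x) s (s ^ n) ⟩
    s * ((∑[ x ← allFinList s ] c x) * s ^ n)
      ≡⟨ cong (s *_) (∑-*ʳ (allFinList s) c (s ^ n)) ⟨
    s * ∑[ x ← allFinList s ] (c x * s ^ n)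
      ≤⟨ *-monoʳ-≤ s (∑-mono (allFinList s) (λ x → covering≤#covers n A (T - x))) ⟩
    s * ∑[ x ← allFinList s ] (#covers A (T - x) * s ^ ∣ A ∣)
      ≡⟨ cong (s *_) (∑-*ʳ (allFinList s) (λ x → #covers A (T - x)) (s ^ ∣ A ∣)) ⟩
    s * ((∑[ x ← allFinList s ] #covers A (T - x)) * s ^ ∣ A ∣)
      ≤⟨ *-monoʳ-≤ s (*-monoˡ-≤ (s ^ ∣ A ∣) (#covers-inside A T)) ⟩
    s * (#covers (inside ∷ A) T * s ^ ∣ A ∣)
      ≡⟨ x*[y*z]≡y*[x*z] s (#covers (inside ∷ A) T) (s ^ ∣ A ∣) ⟩
    #covers (inside ∷ A) T * (s * s ^ ∣ A ∣) ∎
    where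
    open ≤-Reasoning
    c = λ x → covering ∣ A ∣ (∣ T - x ∣) (s ∸ ∣ T - x ∣)

  cutAlong : ∀ {n s} → Subset n → Cut n s → Cut n (suc s)
  cutAlong []      []      = []
  cutAlong (b ∷ U) (x ∷ g) = (if b then suc x else zero) ∷ cutAlong U g

  lookup-cutAlong-∈ : ∀ {n s} {U : Subset n} (g : Cut n s) {v} →
                      v ∈ U → lookup (cutAlong U g) v ≡ suc (lookup g v)
  lookup-cutAlong-∈ (x ∷ g) here        = refl
  lookup-cutAlong-∈ (x ∷ g) (there v∈U) = lookup-cutAlong-∈ g v∈U

  lookup-cutAlong-∉ : ∀ {n s} (U : Subset n) (g : Cut n s) v → v ∉ U → lookup (cutAlong U g) v ≡ zero
  lookup-cutAlong-∉ (inside  ∷ U) (x ∷ g) zero    v∉U = ⊥-elim (v∉U here)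
  lookup-cutAlong-∉ (outside ∷ U) (x ∷ g) zero    v∉U = refl
  lookup-cutAlong-∉ (b       ∷ U) (x ∷ g) (suc v) v∉U = lookup-cutAlong-∉ U g v (v∉U ∘ there)

  ⊈⇒∃∉ : ∀ {n} {p q : Subset n} → p ⊈ q → ∃ λ x → x ∈ p × x ∉ q
  ⊈⇒∃∉ {n} {p} {q} p⊈q with ¬∀⟶∃¬ n _ (λ x → x ∈? p →-dec x ∈? q) (λ p⊆q → p⊈q (p⊆q _))
  ... | x , x∈p⇏x∈q =
    x , decidable-stable (x ∈? p) (λ x∉p → x∈p⇏x∈q (⊥-elim ∘ x∉p)) , x∈p⇏x∈q ∘ const

  Crossing : ∀ {n} → ℕ → Subset n → Subset n → Set
  Crossing k U e = k ∸ 1 ≤ ∣ e ∩ U ∣ × e ⊈ U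

  crossing? : ∀ {n} k (U : Subset n) → Decidable (Crossing k U)
  crossing? k U e = k ∸ 1 ≤? ∣ e ∩ U ∣ ×-dec ¬? (e ⊆? U)

  #edgesCrossing : ∀ {n k} → MultiHypergraph n k → Subset n → ℕ
  #edgesCrossing {k = k} H U = length (filter (crossing? k U) (edges H))

  cutAlong-cuts : ∀ {n s} (U e : Subset n) (g : Cut n s) {w} →
                  Covers (e ∩ U) ⊤ g → w ∈ e → w ∉ U → IsCutBy (cutAlong U g) e
  cutAlong-cuts U e g {w} covers w∈e w∉U zero    = w , w∈e , lookup-cutAlong-∉ U g w w∉U
  cutAlong-cuts U e g     covers w∈e w∉U (suc j) with covers j ∈⊤
  ... | v , v∈e∩U , gv≡j with x∈p∩q⁻ e U v∈e∩U
  ...   | v∈e , v∈U = v , v∈e , trans (lookup-cutAlong-∈ g v∈U) (cong suc gv≡j)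

  covering-⊤ : ∀ a s → covering a ∣ ⊤ {s} ∣ (s ∸ ∣ ⊤ {s} ∣) ≡ covering a s 0
  covering-⊤ a s = cong₂ (covering a) (∣⊤∣≡n s) (trans (cong (s ∸_) (∣⊤∣≡n s)) (n∸n≡0 s))

  crossing-edge-often-cut : ∀ {n k s} (U e : Subset n) → ∣ e ∣ ≡ k →
    𝟙 (crossing? k U e) * (covering (k ∸ 1) s 0 * s ^ n)
      ≤ (∑[ g ← allCuts n s ] 𝟙 (isCutBy? (cutAlong U g) e)) * s ^ (k ∸ 1)
  crossing-edge-often-cut {n} {k} {s} U e ∣e∣≡k with crossing? k U e
  ... | no  _ = z≤n
  ... | yes (k∸1≤∣e∩U∣ , e⊈U) with ⊈⇒∃∉ e⊈U
  ...   | w , w∈e , w∉U = begin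
    1 * (covering (k ∸ 1) s 0 * s ^ n)        ≡⟨ *-identityˡ _ ⟩
    covering (k ∸ 1) s 0 * s ^ n              ≡⟨ cong (λ b → covering b s 0 * s ^ n) a≡k∸1 ⟨
    covering a s 0 * s ^ n                    ≡⟨ cong (_* s ^ n) (covering-⊤ a s) ⟨
    covering a ∣ ⊤ {s} ∣ (s ∸ ∣ ⊤ {s} ∣) * s ^ n ≤⟨ covering≤#covers n (e ∩ U) ⊤ ⟩
    #covers (e ∩ U) ⊤ * s ^ a                 ≤⟨ *-monoˡ-≤ (s ^ a) (∑-mono (allCuts n s) covered⇒cut) ⟩
    #cuts * s ^ a                             ≡⟨ cong (λ b → #cuts * s ^ b) a≡k∸1 ⟩
    #cuts * s ^ (k ∸ 1)                       ∎
    where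
    open ≤-Reasoning
    a = ∣ e ∩ U ∣
    #cuts = ∑[ g ← allCuts n s ] 𝟙 (isCutBy? (cutAlong U g) e)
    a<k : a < k
    a<k = subst (a <_) ∣e∣≡k (p⊂q⇒∣p∣<∣q∣ (p∩q⊆p e U , w , w∈e , w∉U ∘ proj₂ ∘ x∈p∩q⁻ e U))
    a≡k∸1 : a ≡ k ∸ 1
    a≡k∸1 = ≤-antisym (∸-monoˡ-≤ 1 a<k) k∸1≤∣e∩U∣
    covered⇒cut : ∀ g → 𝟙 (covers? (e ∩ U) ⊤ g) ≤ 𝟙 (isCutBy? (cutAlong U g) e)
    covered⇒cut g = 𝟙-mono (λ covers → cutAlong-cuts U e g covers w∈e w∉U)
                           (covers? (e ∩ U) ⊤ g) (isCutBy? (cutAlong U g) e)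

  #edgesCrossing*covering≤maxCut : ∀ {n k} (H : MultiHypergraph n k) (U : Subset n) s →
    #edgesCrossing H U * covering (k ∸ 1) (suc s) 0 ≤ maxCut H (suc (suc s)) * suc s ^ (k ∸ 1)
  #edgesCrossing*covering≤maxCut {n} {k} H U s′ = *-cancelˡ-≤ (s ^ n) {{m^n≢0 s n}} (begin
    s ^ n * (#edgesCrossing H U * Y)
      ≡⟨ x*[y*z]≡y*[x*z] (s ^ n) (#edgesCrossing H U) Y ⟩
    #edgesCrossing H U * (s ^ n * Y)
      ≡⟨ cong₂ _*_ (length-filter (crossing? k U) es) (*-comm (s ^ n) Y) ⟩
    (∑[ e ← es ] 𝟙 (crossing? k U e)) * (Y * s ^ n)
      ≡⟨ ∑-*ʳ es (𝟙 ∘ crossing? k U) (Y * s ^ n) ⟨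
    ∑[ e ← es ] (𝟙 (crossing? k U e) * (Y * s ^ n))
      ≤⟨ ∑-mono-All (All.map (crossing-edge-often-cut U _) (uniform H)) ⟩
    ∑[ e ← es ] ((∑[ g ← G ] 𝟙 (isCutBy? (cutAlong U g) e)) * s ^ a)
      ≡⟨ ∑-*ʳ es (λ e → ∑[ g ← G ] 𝟙 (isCutBy? (cutAlong U g) e)) (s ^ a) ⟩
    (∑[ e ← es ] ∑[ g ← G ] 𝟙 (isCutBy? (cutAlong U g) e)) * s ^ a
      ≡⟨ cong (_* s ^ a) (∑-swap es G (λ e g → 𝟙 (isCutBy? (cutAlong U g) e))) ⟩
    (∑[ g ← G ] ∑[ e ← es ] 𝟙 (isCutBy? (cutAlong U g) e)) * s ^ a
      ≡⟨ cong (_* s ^ a) (∑-cong G (λ g → length-filter (isCutBy? (cutAlong U g)) es)) ⟨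
    (∑[ g ← G ] cutSize H (cutAlong U g)) * s ^ a
      ≤⟨ *-monoˡ-≤ (s ^ a) (∑-mono G (λ g → ≤-foldr-⊔ (cutSize H) (∈-allCuts (cutAlong U g)))) ⟩
    (∑[ _ ← G ] maxCut H (suc s)) * s ^ a
      ≡⟨ cong (_* s ^ a) (∑-allCuts-const n s (maxCut H (suc s))) ⟩
    s ^ n * maxCut H (suc s) * s ^ a
      ≡⟨ *-assoc (s ^ n) _ _ ⟩
    s ^ n * (maxCut H (suc s) * s ^ a) ∎)
    where
    open ≤-Reasoning
    s = suc s′
    a = k ∸ 1
    es = edges H
    G = allCuts n s
    Y = covering a s 0

  #edgesNearlyIn≤#edgesCrossing+#edgesInduced : ∀ {n k} (H : MultiHypergraph n k) (U : Subset n) →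
    #edgesNearlyIn H U ≤ #edgesCrossing H U + #edgesInduced H U
  #edgesNearlyIn≤#edgesCrossing+#edgesInduced {k = k} H U = begin
    #edgesNearlyIn H U
      ≡⟨ length-filter (λ e → k ∸ 1 ≤? ∣ e ∩ U ∣) es ⟩
    ∑[ e ← es ] 𝟙 (k ∸ 1 ≤? ∣ e ∩ U ∣)
      ≤⟨ ∑-mono es (λ e → 𝟙-split (k ∸ 1 ≤? ∣ e ∩ U ∣) (e ⊆? U)) ⟩
    ∑[ e ← es ] (𝟙 (crossing? k U e) + 𝟙 (e ⊆? U))
      ≡⟨ ∑-+ es (𝟙 ∘ crossing? k U) (λ e → 𝟙 (e ⊆? U)) ⟩
    ∑[ e ← es ] 𝟙 (crossing? k U e) + ∑[ e ← es ] 𝟙 (e ⊆? U)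
      ≡⟨ cong₂ _+_ (length-filter (crossing? k U) es) (length-filter (_⊆? U) es) ⟨
    #edgesCrossing H U + #edgesInduced H U ∎
    where
    open ≤-Reasoning
    es = edges H

module SurplusBound where
  open import Data.Nat
  open import Data.Nat.Properties
  open import Data.Nat.Solver using (module +-*-Solver)
  open import Data.Fin.Subset using (Subset)
  open import Relation.Binary.PropositionalEquality
  open CoveringNumbers
  open CutAveraging
  open +-*-Solver

  ε⁻¹ : ℕ → ℕ
  ε⁻¹ k = suc (3 * (k ^ k * k ^ k))

  crossing-almost-all : ∀ L m NI E I →
    L * m ≤ L * NI + m → L * I ≤ m → NI ≤ E + I → L * m ≤ L * E + 2 * m
  crossing-almost-all L m NI E I nearly-all few-induced NI≤E+I = begin
    L * m              ≤⟨ nearly-all ⟩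
    L * NI + m         ≤⟨ +-monoˡ-≤ m (*-monoʳ-≤ L NI≤E+I) ⟩
    L * (E + I) + m    ≡⟨ cong (_+ m) (*-distribˡ-+ L E I) ⟩
    L * E + L * I + m  ≤⟨ +-monoˡ-≤ m (+-monoʳ-≤ (L * E) few-induced) ⟩
    L * E + m + m      ≡⟨ solve 2 (λ x m → x :+ m :+ m := x :+ con 2 :* m) refl (L * E) m ⟩
    L * E + 2 * m      ∎
    where open ≤-Reasoning

  -- With p = Y / P₁ and q = X / P₂: from (1 − 2 / L) m ≤ E, E p ≤ M, q ≤ p (1 − 1 / P₂) and
  -- 1 / L ≤ p / P₂ − 2 p / L follows m / L + q m ≤ M.
  surplus-arithmetic : ∀ L m E M Y X P₁ P₂ →
    L * m ≤ L * E + 2 * m → E * Y ≤ M * P₁ → X * P₁ + Y ≤ Y * P₂ →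
    P₁ * P₂ + 2 * P₂ * Y ≤ L * Y → 0 < P₁ → m * P₂ + L * X * m ≤ L * P₂ * M
  surplus-arithmetic L m E M Y X P₁ P₂ crossing averaging gap L-large 0<P₁ =
    *-cancelˡ-≤ P₁ {{>-nonZero 0<P₁}} (+-cancelʳ-≤ (L * m * Y) _ _ (begin
      P₁ * (m * P₂ + L * X * m) + L * m * Y
        ≡⟨ solve 6 (λ L m X P₁ P₂ Y → P₁ :* (m :* P₂ :+ L :* X :* m) :+ L :* m :* Y
                      := m :* (P₁ :* P₂) :+ L :* m :* (X :* P₁ :+ Y)) refl L m X P₁ P₂ Y ⟩
      m * (P₁ * P₂) + L * m * (X * P₁ + Y)
        ≤⟨ +-monoʳ-≤ (m * (P₁ * P₂)) (*-monoʳ-≤ (L * m) gap) ⟩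
      m * (P₁ * P₂) + L * m * (Y * P₂)
        ≤⟨ +-monoʳ-≤ (m * (P₁ * P₂)) (*-monoˡ-≤ (Y * P₂) crossing) ⟩
      m * (P₁ * P₂) + (L * E + 2 * m) * (Y * P₂)
        ≡⟨ solve 6 (λ L m E P₁ P₂ Y → m :* (P₁ :* P₂) :+ (L :* E :+ con 2 :* m) :* (Y :* P₂)
                      := L :* P₂ :* (E :* Y) :+ m :* (P₁ :* P₂ :+ con 2 :* P₂ :* Y)) refl L m E P₁ P₂ Y ⟩
      L * P₂ * (E * Y) + m * (P₁ * P₂ + 2 * P₂ * Y)
        ≤⟨ +-mono-≤ (*-monoʳ-≤ (L * P₂) averaging) (*-monoʳ-≤ m L-large) ⟩
      L * P₂ * (M * P₁) + m * (L * Y)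
        ≡⟨ solve 6 (λ L m M P₁ P₂ Y → L :* P₂ :* (M :* P₁) :+ m :* (L :* Y)
                      := P₁ :* (L :* P₂ :* M) :+ L :* m :* Y) refl L m M P₁ P₂ Y ⟩
      P₁ * (L * P₂ * M) + L * m * Y ∎))
    where open ≤-Reasoning

  ε⁻¹-large : ∀ k P₁ P₂ Y → P₁ ≤ k ^ k → P₂ ≤ k ^ k → 0 < P₁ → 0 < Y →
              P₁ * P₂ + 2 * P₂ * Y ≤ ε⁻¹ k * Y
  ε⁻¹-large k P₁ P₂ Y P₁≤ P₂≤ 0<P₁ 0<Y = begin
    P₁ * P₂ + 2 * P₂ * Y               ≤⟨ +-mono-≤ (m≤m*n (P₁ * P₂) Y {{>-nonZero 0<Y}})
                                                    (*-monoʳ-≤ (2 * P₂) (m≤n*m Y P₁ {{>-nonZero 0<P₁}})) ⟩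
    P₁ * P₂ * Y + 2 * P₂ * (P₁ * Y)    ≡⟨ solve 3 (λ p q y → p :* q :* y :+ con 2 :* q :* (p :* y)
                                                           := con 3 :* (p :* q) :* y) refl P₁ P₂ Y ⟩
    3 * (P₁ * P₂) * Y                  ≤⟨ *-monoˡ-≤ Y (*-monoʳ-≤ 3 (*-mono-≤ P₁≤ P₂≤)) ⟩
    3 * (k ^ k * k ^ k) * Y            ≤⟨ *-monoˡ-≤ Y (n≤1+n (3 * (k ^ k * k ^ k))) ⟩
    ε⁻¹ k * Y                          ∎
    where open ≤-Reasoning

  -- m / L ≤ maxCut H r − (S k r * r ! / r ^ k) * m, with the denominators cleared.
  surplus-cleared : ∀ {n} a s′ (H : MultiHypergraph n (suc a)) (U : Subset n) → suc s′ ≤ a →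
    let k = suc a; r = suc (suc s′); L = ε⁻¹ k; m = #edges H in
    L * m ≤ L * #edgesNearlyIn H U + m → L * #edgesInduced H U ≤ m →
    m * r ^ k + S k r * r ! * m * L ≤ maxCut H r * (L * r ^ k)
  surplus-cleared a s′ H U s≤a nearly-all few-induced = begin
    m * r ^ k + S k r * r ! * m * L    ≡⟨ cong (λ c → m * r ^ k + c * m * L) coefficient ⟩
    m * (r * P₂) + r * X * m * L       ≡⟨ solve 5 (λ m r P₂ X L → m :* (r :* P₂) :+ r :* X :* m :* L
                                                    := r :* (m :* P₂ :+ L :* X :* m)) refl m r P₂ X L ⟩
    r * (m * P₂ + L * X * m)           ≤⟨ *-monoʳ-≤ r core ⟩
    r * (L * P₂ * M)                   ≡⟨ solve 4 (λ r L P₂ M → r :* (L :* P₂ :* M) := M :* (L :* (r :* P₂)))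
                                            refl r L P₂ M ⟩
    M * (L * r ^ k)                    ∎
    where
    open ≤-Reasoning
    k = suc a
    s = suc s′
    r = suc s
    L = ε⁻¹ k
    m = #edges H
    M = maxCut H r
    E = #edgesCrossing H U
    P₁ = s ^ a
    P₂ = r ^ a
    X = covering a s 1
    Y = covering a s 0
    coefficient : S k r * r ! ≡ r * X
    coefficient = trans (*-comm (S k r) (r !)) (sym (covering-surjections k r))
    gap : X * P₁ + Y ≤ Y * P₂
    gap = subst (λ t → X * t ^ a + Y ≤ Y * suc t ^ a) (+-identityʳ s) (covering-gap a s′ 0)
    pow≤k^k : ∀ {x} → x ≤ k → x ^ a ≤ k ^ k
    pow≤k^k x≤k = ≤-trans (^-monoˡ-≤ a x≤k) (^-monoʳ-≤ k (n≤1+n a))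
    L-large : P₁ * P₂ + 2 * P₂ * Y ≤ L * Y
    L-large = ε⁻¹-large k P₁ P₂ Y (pow≤k^k (m≤n⇒m≤1+n s≤a)) (pow≤k^k (s≤s s≤a)) (m^n>0 s a)
                (covering-positive a s 0 s≤a z<s)
    core : m * P₂ + L * X * m ≤ L * P₂ * M
    core = surplus-arithmetic L m E M Y X P₁ P₂
      (crossing-almost-all L m (#edgesNearlyIn H U) E (#edgesInduced H U) nearly-all few-induced
        (#edgesNearlyIn≤#edgesCrossing+#edgesInduced H U))
      (#edgesCrossing*covering≤maxCut H U s′) gap L-large (m^n>0 s a)

module NatToRational where
  open import Data.Nat as ℕ using (suc; NonZero)
  import Data.Nat.Properties as ℕ
  open import Data.Integer as ℤ using (+_; +≤+)
  import Data.Integer.Properties as ℤ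
  open import Data.Rational as ℚ using (1ℚ; _/_; toℚᵘ; _+_; _*_; _-_; _≤_; Positive)
  open import Data.Rational.Properties
  open import Data.Rational.Unnormalised as ℚᵘ using (mkℚᵘ; *≡*; *≤*)
  import Data.Rational.Unnormalised.Properties as ℚᵘ
  open import Data.Rational.Solver using (module +-*-Solver)
  open import Relation.Binary.PropositionalEquality

  private
    toℚᵘ-ℕtoℚ : ∀ a → toℚᵘ (ℕtoℚ a) ℚᵘ.≃ mkℚᵘ (+ a) 0
    toℚᵘ-ℕtoℚ a = toℚᵘ-fromℚᵘ (mkℚᵘ (+ a) 0)

  ℕtoℚ-+ : ∀ a b → ℕtoℚ (a ℕ.+ b) ≡ ℕtoℚ a + ℕtoℚ b
  ℕtoℚ-+ a b = toℚᵘ-injective (begin-equality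
    toℚᵘ (ℕtoℚ (a ℕ.+ b))                       ≃⟨ toℚᵘ-ℕtoℚ (a ℕ.+ b) ⟩
    mkℚᵘ (+ (a ℕ.+ b)) 0                        ≃⟨ *≡* integers ⟩
    mkℚᵘ (+ a) 0 ℚᵘ.+ mkℚᵘ (+ b) 0              ≃⟨ ℚᵘ.+-cong (toℚᵘ-ℕtoℚ a) (toℚᵘ-ℕtoℚ b) ⟨
    toℚᵘ (ℕtoℚ a) ℚᵘ.+ toℚᵘ (ℕtoℚ b)            ≃⟨ toℚᵘ-homo-+ (ℕtoℚ a) (ℕtoℚ b) ⟨
    toℚᵘ (ℕtoℚ a + ℕtoℚ b)                      ∎)
    where
    open ℚᵘ.≤-Reasoning
    integers : + (a ℕ.+ b) ℤ.* + 1 ≡ (+ a ℤ.* + 1 ℤ.+ + b ℤ.* + 1) ℤ.* + 1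
    integers rewrite ℤ.*-identityʳ (+ a) | ℤ.*-identityʳ (+ b) = cong (ℤ._* + 1) (ℤ.pos-+ a b)

  ℕtoℚ-* : ∀ a b → ℕtoℚ (a ℕ.* b) ≡ ℕtoℚ a * ℕtoℚ b
  ℕtoℚ-* a b = toℚᵘ-injective (begin-equality
    toℚᵘ (ℕtoℚ (a ℕ.* b))                       ≃⟨ toℚᵘ-ℕtoℚ (a ℕ.* b) ⟩
    mkℚᵘ (+ (a ℕ.* b)) 0                        ≃⟨ *≡* (cong (ℤ._* + 1) (ℤ.pos-* a b)) ⟩
    mkℚᵘ (+ a) 0 ℚᵘ.* mkℚᵘ (+ b) 0              ≃⟨ ℚᵘ.*-cong (toℚᵘ-ℕtoℚ a) (toℚᵘ-ℕtoℚ b) ⟨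
    toℚᵘ (ℕtoℚ a) ℚᵘ.* toℚᵘ (ℕtoℚ b)            ≃⟨ toℚᵘ-homo-* (ℕtoℚ a) (ℕtoℚ b) ⟨
    toℚᵘ (ℕtoℚ a * ℕtoℚ b)                      ∎)
    where open ℚᵘ.≤-Reasoning

  ℕtoℚ-mono-≤ : ∀ {a b} → a ℕ.≤ b → ℕtoℚ a ≤ ℕtoℚ b
  ℕtoℚ-mono-≤ {a} {b} a≤b = toℚᵘ-cancel-≤ (begin
    toℚᵘ (ℕtoℚ a)  ≃⟨ toℚᵘ-ℕtoℚ a ⟩
    mkℚᵘ (+ a) 0   ≤⟨ *≤* (subst₂ ℤ._≤_ (sym (ℤ.*-identityʳ (+ a))) (sym (ℤ.*-identityʳ (+ b)))
                                 (+≤+ a≤b)) ⟩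
    mkℚᵘ (+ b) 0   ≃⟨ toℚᵘ-ℕtoℚ b ⟨
    toℚᵘ (ℕtoℚ b)  ∎)
    where open ℚᵘ.≤-Reasoning

  ℕtoℚ-cancel-≤ : ∀ {a b} → ℕtoℚ a ≤ ℕtoℚ b → a ℕ.≤ b
  ℕtoℚ-cancel-≤ {a} {b} ιa≤ιb =
    ℤ.drop‿+≤+ (subst₂ ℤ._≤_ (ℤ.*-identityʳ (+ a)) (ℤ.*-identityʳ (+ b)) (ℚᵘ.drop-*≤* (begin
    mkℚᵘ (+ a) 0   ≃⟨ toℚᵘ-ℕtoℚ a ⟨
    toℚᵘ (ℕtoℚ a)  ≤⟨ toℚᵘ-mono-≤ ιa≤ιb ⟩
    toℚᵘ (ℕtoℚ b)  ≃⟨ toℚᵘ-ℕtoℚ b ⟩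
    mkℚᵘ (+ b) 0   ∎)))
    where open ℚᵘ.≤-Reasoning

  ℕtoℚ-pos : ∀ n .{{_ : NonZero n}} → Positive (ℕtoℚ n)
  ℕtoℚ-pos n = normalize-pos n 1

  /-*-ℕtoℚ : ∀ a d .{{_ : NonZero d}} → (+ a / d) * ℕtoℚ d ≡ ℕtoℚ a
  /-*-ℕtoℚ a (suc d) = toℚᵘ-injective (begin-equality
    toℚᵘ ((+ a / suc d) * ℕtoℚ (suc d))             ≃⟨ toℚᵘ-homo-* (+ a / suc d) (ℕtoℚ (suc d)) ⟩
    toℚᵘ (+ a / suc d) ℚᵘ.* toℚᵘ (ℕtoℚ (suc d))
      ≃⟨ ℚᵘ.*-cong (toℚᵘ-fromℚᵘ (mkℚᵘ (+ a) d)) (toℚᵘ-ℕtoℚ (suc d)) ⟩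
    mkℚᵘ (+ a) d ℚᵘ.* mkℚᵘ (+ suc d) 0              ≃⟨ *≡* integers ⟩
    mkℚᵘ (+ a) 0                                    ≃⟨ toℚᵘ-ℕtoℚ a ⟨
    toℚᵘ (ℕtoℚ a)                                   ∎)
    where
    open ℚᵘ.≤-Reasoning
    integers : (+ a ℤ.* + suc d) ℤ.* + 1 ≡ + a ℤ.* + (suc d ℕ.* 1)
    integers = trans (ℤ.*-identityʳ _) (cong (λ n → + a ℤ.* + n) (sym (ℕ.*-identityʳ (suc d))))

  [1-1/L]*m≤n⇒L*m≤L*n+m : ∀ L m n .{{_ : NonZero L}} →
    (1ℚ - + 1 / L) * ℕtoℚ m ≤ ℕtoℚ n → L ℕ.* m ℕ.≤ L ℕ.* n ℕ.+ m
  [1-1/L]*m≤n⇒L*m≤L*n+m L m n h = ℕtoℚ-cancel-≤ (begin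
    ℕtoℚ (L ℕ.* m)
      ≡⟨ ℕtoℚ-* L m ⟩
    ℕtoℚ L * ℕtoℚ m
      ≡⟨ solve 3 (λ l e x → l :* x := l :* ((con 1ℚ :- e) :* x) :+ (e :* l) :* x) refl (ℕtoℚ L) ε (ℕtoℚ m) ⟩
    ℕtoℚ L * ((1ℚ - ε) * ℕtoℚ m) + (ε * ℕtoℚ L) * ℕtoℚ m
      ≤⟨ +-monoˡ-≤ ((ε * ℕtoℚ L) * ℕtoℚ m)
           (*-monoˡ-≤-nonNeg (ℕtoℚ L) {{pos⇒nonNeg (ℕtoℚ L) {{ℕtoℚ-pos L}}}} h) ⟩
    ℕtoℚ L * ℕtoℚ n + (ε * ℕtoℚ L) * ℕtoℚ m
      ≡⟨ cong₂ (λ x y → x + y * ℕtoℚ m) (sym (ℕtoℚ-* L n)) (/-*-ℕtoℚ 1 L) ⟩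
    ℕtoℚ (L ℕ.* n) + ℕtoℚ 1 * ℕtoℚ m
      ≡⟨ cong (λ x → ℕtoℚ (L ℕ.* n) + x) (*-identityˡ (ℕtoℚ m)) ⟩
    ℕtoℚ (L ℕ.* n) + ℕtoℚ m
      ≡⟨ ℕtoℚ-+ (L ℕ.* n) m ⟨
    ℕtoℚ (L ℕ.* n ℕ.+ m) ∎)
    where
    open ≤-Reasoning
    open +-*-Solver
    ε = + 1 / L

  m≤L*n⇒1/L*m≤n : ∀ L m n .{{_ : NonZero L}} → m ℕ.≤ L ℕ.* n → (+ 1 / L) * ℕtoℚ m ≤ ℕtoℚ n
  m≤L*n⇒1/L*m≤n L m n m≤Ln = begin
    ε * ℕtoℚ m               ≤⟨ *-monoˡ-≤-nonNeg ε {{pos⇒nonNeg ε {{normalize-pos 1 L}}}} (ℕtoℚ-mono-≤ m≤Ln) ⟩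
    ε * ℕtoℚ (L ℕ.* n)       ≡⟨ cong (ε *_) (ℕtoℚ-* L n) ⟩
    ε * (ℕtoℚ L * ℕtoℚ n)    ≡⟨ *-assoc ε (ℕtoℚ L) (ℕtoℚ n) ⟨
    (ε * ℕtoℚ L) * ℕtoℚ n    ≡⟨ cong (_* ℕtoℚ n) (/-*-ℕtoℚ 1 L) ⟩
    1ℚ * ℕtoℚ n              ≡⟨ *-identityˡ (ℕtoℚ n) ⟩
    ℕtoℚ n                   ∎
    where
    open ≤-Reasoning
    ε = + 1 / L

  m*R+C*m*L≤M*[L*R]⇒1/L*m≤M-C/R*m : ∀ L R C m M .{{_ : NonZero L}} .{{_ : NonZero R}} →
    m ℕ.* R ℕ.+ C ℕ.* m ℕ.* L ℕ.≤ M ℕ.* (L ℕ.* R) →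
    (+ 1 / L) * ℕtoℚ m ≤ ℕtoℚ M - (+ C / R) * ℕtoℚ m
  m*R+C*m*L≤M*[L*R]⇒1/L*m≤M-C/R*m L R C m M cleared = begin
    ε * ℕtoℚ m
      ≡⟨ solve 3 (λ e c x → e :* x := (e :* x :+ c :* x) :- c :* x) refl ε γ (ℕtoℚ m) ⟩
    (ε * ℕtoℚ m + γ * ℕtoℚ m) - γ * ℕtoℚ m
      ≤⟨ +-monoˡ-≤ (ℚ.- (γ * ℕtoℚ m)) sum≤M ⟩
    ℕtoℚ M - γ * ℕtoℚ m ∎
    where
    open ≤-Reasoning
    open +-*-Solver
    ε = + 1 / L
    γ = + C / R
    instance _ = ℕ.m*n≢0 L R
    sum≤M : ε * ℕtoℚ m + γ * ℕtoℚ m ≤ ℕtoℚ M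
    sum≤M = *-cancelʳ-≤-pos (ℕtoℚ (L ℕ.* R)) {{ℕtoℚ-pos (L ℕ.* R)}} (begin
      (ε * ℕtoℚ m + γ * ℕtoℚ m) * ℕtoℚ (L ℕ.* R)
        ≡⟨ cong (λ x → (ε * ℕtoℚ m + γ * ℕtoℚ m) * x) (ℕtoℚ-* L R) ⟩
      (ε * ℕtoℚ m + γ * ℕtoℚ m) * (ℕtoℚ L * ℕtoℚ R)
        ≡⟨ solve 5 (λ e c x l r → (e :* x :+ c :* x) :* (l :* r)
                                := (e :* l) :* x :* r :+ (c :* r) :* x :* l)
             refl ε γ (ℕtoℚ m) (ℕtoℚ L) (ℕtoℚ R) ⟩
      (ε * ℕtoℚ L) * ℕtoℚ m * ℕtoℚ R + (γ * ℕtoℚ R) * ℕtoℚ m * ℕtoℚ L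
        ≡⟨ cong₂ (λ x y → x * ℕtoℚ m * ℕtoℚ R + y * ℕtoℚ m * ℕtoℚ L) (/-*-ℕtoℚ 1 L) (/-*-ℕtoℚ C R) ⟩
      1ℚ * ℕtoℚ m * ℕtoℚ R + ℕtoℚ C * ℕtoℚ m * ℕtoℚ L
        ≡⟨ cong (λ x → x * ℕtoℚ R + ℕtoℚ C * ℕtoℚ m * ℕtoℚ L) (*-identityˡ (ℕtoℚ m)) ⟩
      ℕtoℚ m * ℕtoℚ R + ℕtoℚ C * ℕtoℚ m * ℕtoℚ L
        ≡⟨ cong₂ _+_ (ℕtoℚ-* m R) (trans (ℕtoℚ-* (C ℕ.* m) L) (cong (_* ℕtoℚ L) (ℕtoℚ-* C m))) ⟨
      ℕtoℚ (m ℕ.* R) + ℕtoℚ (C ℕ.* m ℕ.* L)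
        ≡⟨ ℕtoℚ-+ (m ℕ.* R) (C ℕ.* m ℕ.* L) ⟨
      ℕtoℚ (m ℕ.* R ℕ.+ C ℕ.* m ℕ.* L)
        ≤⟨ ℕtoℚ-mono-≤ cleared ⟩
      ℕtoℚ (M ℕ.* (L ℕ.* R))
        ≡⟨ ℕtoℚ-* M (L ℕ.* R) ⟩
      ℕtoℚ M * ℕtoℚ (L ℕ.* R) ∎)

open import Data.Nat using (ℕ; _≤_)
open import Data.Rational using (ℚ; 0ℚ; 1ℚ; _<_; _-_; _*_) renaming (_≤_ to _≤ℚ_)
open import Data.Fin.Subset using (Subset)
open import Data.Product using (Σ; _×_; _,_)
open import Data.Sum using (_⊎_; inj₁; inj₂; [_,_]′)
open import Data.Nat as ℕ using (suc; s≤s; z≤n)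
open import Data.Nat.Properties using (<⇒≤; ≤-<-connex; m^n≢0)
open import Data.Integer using (+_)
open import Data.Rational using (_/_)
open import Data.Rational.Properties using (positive⁻¹; normalize-pos)
open import Function using (_∘_)
open SurplusBound using (ε⁻¹; surplus-cleared)
open NatToRational
  using ([1-1/L]*m≤n⇒L*m≤L*n+m; m≤L*n⇒1/L*m≤n; m*R+C*m*L≤M*[L*R]⇒1/L*m≤M-C/R*m)

ε : ℕ → ℚ
ε k = + 1 / ε⁻¹ k

ε>0 : ∀ k → 0ℚ < ε k
ε>0 k = positive⁻¹ (ε k) {{normalize-pos 1 (ε⁻¹ k)}}

surplus-or-induced : ∀ k r n → 2 ≤ r → r ≤ k → (H : MultiHypergraph n k) → (U : Subset n) →
  (1ℚ - ε k) * ℕtoℚ (#edges H) ≤ℚ ℕtoℚ (#edgesNearlyIn H U) →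
  (ε k * ℕtoℚ (#edges H) ≤ℚ surplus H r) ⊎ (ε k * ℕtoℚ (#edges H) ≤ℚ ℕtoℚ (#edgesInduced H U))
surplus-or-induced (suc a) (suc (suc s′)) n (s≤s (s≤s z≤n)) (s≤s s≤a) H U nearly-all =
  [ inj₂ ∘ induced-case , inj₁ ∘ surplus-case ∘ <⇒≤ ]′ (≤-<-connex m (L ℕ.* I))
  where
  k = suc a
  r = suc (suc s′)
  L = ε⁻¹ k
  m = #edges H
  I = #edgesInduced H U
  instance _ = m^n≢0 r k
  induced-case : m ≤ L ℕ.* I → ε k * ℕtoℚ m ≤ℚ ℕtoℚ I
  induced-case = m≤L*n⇒1/L*m≤n L m I
  surplus-case : L ℕ.* I ≤ m → ε k * ℕtoℚ m ≤ℚ surplus H r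
  surplus-case few-induced =
    m*R+C*m*L≤M*[L*R]⇒1/L*m≤M-C/R*m L (r ℕ.^ k) (S k r ℕ.* r ℕ.!) m (maxCut H r)
      (surplus-cleared a s′ H U s≤a
        ([1-1/L]*m≤n⇒L*m≤L*n+m L m (#edgesNearlyIn H U) nearly-all) few-induced)

lemma3p6 : (k : ℕ) →
    Σ ℚ λ ε → Σ ℚ λ c → (0ℚ < ε) × (0ℚ < c) ×
      ((r n : ℕ) → 2 ≤ r → r ≤ k → (H : MultiHypergraph n k) → (U : Subset n) →
        (1ℚ - ε) * ℕtoℚ (#edges H) ≤ℚ ℕtoℚ (#edgesNearlyIn H U) →
        (c * ℕtoℚ (#edges H) ≤ℚ surplus H r) ⊎ (c * ℕtoℚ (#edges H) ≤ℚ ℕtoℚ (#edgesInduced H U)))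
lemma3p6 k = ε k , ε k , ε>0 k , ε>0 k , surplus-or-induced k
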